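{- Let $p^l$ be a prime power, and let $N$ be an integer that is exactly divisible by $p^l$. Let $c/d$ be a rational number with $d$ dividing $N$, and let $S$ be a set of integers dividing $N$ that are all exactly divisible by $p^l$. If $|S|\ge p-1$, then there is a subset $T$ of $S$ with $|T|<p$ such that, if we define \[ \frac{c'}{d'}=\frac cd+\sum_{n\in T}\frac1n \] with $c'/d'$ in lowest terms, then $d'$ divides $N/p$.
   Context: An integer $n$ is exactly divisible by the prime power $p^l$ if $p^l\mid n$ but $p^{l+1}\nmid n$. -}

module Defs where

open import Data.Nat as ℕ using (ℕ; suc; _^_)
open import Data.Integer using (ℤ; +_; -[1+_]; -_)
open import Data.Integer.Divisibility using (_∣_)
open import Data.Rational using (ℚ; _/_; _+_; 0ℚ)
open import Data.List using (List; []; _∷_)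
open import Data.Product using (_×_)
open import Relation.Nullary using (¬_)

-- The rational number c/d for integers c, d (d ≠ 0); value 0 if d = 0
-- (never used, since all denominators in the statement are nonzero).
_//_ : ℤ → ℤ → ℚ
c // (+ 0)      = 0ℚ
c // (+ suc n)  = c / suc n
c // -[1+ n ]   = (- c) / suc n

sumRecip : List ℤ → ℚ
sumRecip []      = 0ℚ
sumRecip (n ∷ T) = ((+ 1) // n) + sumRecip T

ExactlyDivides : ℕ → ℕ → ℤ → Set
ExactlyDivides p l n = (+ (p ^ l) ∣ n) × ¬ (+ (p ^ suc l) ∣ n)

module Submission where

-- Put every fraction over the common denominator N = p M.  Then c/d + Σ_{n ∈ T} 1/n is
-- ((N/d) c + Σ_{n ∈ T} N/n) / N, and its reduced denominator divides M as soon as p divides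
-- the numerator.  Since p^l exactly divides both N and n, every N/n is a unit modulo p, so
-- it suffices that the subset sums of p − 1 units modulo p hit every residue.  If A is the
-- set of residues of the subset sums of some units, adding a further unit z gives A ∪ (A + z);
-- this is strictly larger than A unless A + z ⊆ A, in which case A, which contains 0, contains
-- every multiple of z and hence everything.  So k units reach at least min (p , k + 1)
-- residues, and the first p − 1 elements of S already suffice, which keeps |T| < p.

open import Data.Nat.Base using (ℕ)
open import Data.Nat.Primality using (Prime)

module Residues (p : ℕ) .{{_ : Data.Nat.Base.NonZero p}} where

  open import Data.Nat.Base as ℕ using (zero; suc)
  open import Data.Nat.Properties using (≤-<-trans; ⊔-lub)
  open import Data.Nat.DivMod using (m<n⇒m%n≡m)
  open import Data.Nat.Divisibility using (>⇒∤) renaming (_∣_ to _∣ℕ_)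
  open import Data.Nat.Coprimality using (Coprime; coprime-Bézout)
  open import Data.Nat.GCD using (module Bézout)
  open import Data.Nat.Primality using (prime⇒irreducible)
  open import Data.Fin.Base using (Fin; toℕ; fromℕ<)
  open import Data.Fin.Properties using (toℕ-fromℕ<; toℕ-injective; toℕ<n)
  open import Data.Integer.Base using (ℤ; +_; -[1+_]; 1ℤ; _+_; _-_; _*_; -_; ∣_∣; _/ℕ_)
  open import Data.Integer.Properties
    using (m-n≡m⊖n; ∣m⊝n∣≤m⊔n; ∣i∣≡0⇒i≡0; i-j≡0⇒i≡j; +-injective; pos-+; pos-*)
  open import Data.Integer.DivMod using (n%ℕd<d; a≡a%ℕn+[a/ℕn]*n)
  open import Data.Integer.Divisibility.Signed
    using (_∣_; divides; ∣⇒∣ᵤ; ∣ᵤ⇒∣; ∣m∣n⇒∣m+n; ∣m∣n⇒∣m-n; ∣n⇒∣m*n; ∣m⇒∣-m)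
  open import Data.Integer.Tactic.RingSolver using (solve-∀)
  open import Data.Product using (∃-syntax; _,_)
  open import Data.Sum using (inj₁; inj₂)
  open import Function using (_∘_)
  open import Relation.Nullary using (¬_; contradiction)
  open import Relation.Binary.PropositionalEquality
  open ≡-Reasoning

  residue : ℤ → Fin p
  residue x = fromℕ< (n%ℕd<d x p)

  ≡+*⇒∣- : ∀ {x r} q → x ≡ r + q * + p → + p ∣ x - r
  ≡+*⇒∣- {r = r} q refl = divides q ([r+q]-r≡q r (q * + p))
    where
    [r+q]-r≡q : ∀ r q → r + q - r ≡ q
    [r+q]-r≡q = solve-∀

  ∣-residue : ∀ x → + p ∣ x - + toℕ (residue x)
  ∣-residue x rewrite toℕ-fromℕ< (n%ℕd<d x p) = ≡+*⇒∣- (x /ℕ p) (a≡a%ℕn+[a/ℕn]*n x p)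

  ∣[m-n]⇒m≡n : ∀ {m n} → m ℕ.< p → n ℕ.< p → + p ∣ + m - + n → m ≡ n
  ∣[m-n]⇒m≡n {m} {n} m<p n<p p∣m-n =
    +-injective (i-j≡0⇒i≡j (+ m) (+ n) (∣i∣≡0⇒i≡0 (small-multiple (∣⇒∣ᵤ p∣m-n) ∣m-n∣<p)))
    where
    ∣m-n∣<p : ∣ + m - + n ∣ ℕ.< p
    ∣m-n∣<p rewrite m-n≡m⊖n m n = ≤-<-trans (∣m⊝n∣≤m⊔n m n) (⊔-lub m<p n<p)
    small-multiple : ∀ {k} → p ∣ℕ k → k ℕ.< p → k ≡ 0
    small-multiple {zero} _ _ = refl
    small-multiple {suc k} p∣k k<p = contradiction p∣k (>⇒∤ k<p)

  ∣⇒residue-≡ : ∀ x y → + p ∣ x - y → residue x ≡ residue y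
  ∣⇒residue-≡ x y p∣x-y =
    toℕ-injective (∣[m-n]⇒m≡n (toℕ<n (residue x)) (toℕ<n (residue y)) p∣a-b)
    where
    a = + toℕ (residue x)
    b = + toℕ (residue y)
    regroup : ∀ x y a b → x - y - (x - a) + (y - b) ≡ a - b
    regroup = solve-∀
    p∣a-b : + p ∣ a - b
    p∣a-b = subst (+ p ∣_) (regroup x y a b)
      (∣m∣n⇒∣m+n (∣m∣n⇒∣m-n p∣x-y (∣-residue x)) (∣-residue y))

  residue-≡⇒∣ : ∀ x y → residue x ≡ residue y → + p ∣ x - y
  residue-≡⇒∣ x y eq = subst (+ p ∣_) (regroup x y (+ toℕ (residue y)))
    (∣m∣n⇒∣m-n (subst (λ r → + p ∣ x - + toℕ r) eq (∣-residue x)) (∣-residue y))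
    where
    regroup : ∀ x y r → x - r - (y - r) ≡ x - y
    regroup = solve-∀

  residue-toℕ : ∀ r → residue (+ toℕ r) ≡ r
  residue-toℕ r = toℕ-injective (trans (toℕ-fromℕ< _) (m<n⇒m%n≡m (toℕ<n r)))

  ℕ-affine⇒ℤ : ∀ a b c d e → a ℕ.+ b ℕ.* c ≡ d ℕ.* e → + a + + b * + c ≡ + d * + e
  ℕ-affine⇒ℤ a b c d e eq = begin
    + a + + b * + c    ≡⟨ cong (_+_ (+ a)) (pos-* b c) ⟨
    + a + + (b ℕ.* c)  ≡⟨ pos-+ a (b ℕ.* c) ⟨
    + (a ℕ.+ b ℕ.* c)  ≡⟨ cong +_ eq ⟩
    + (d ℕ.* e)        ≡⟨ pos-* d e ⟩
    + d * + e          ∎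

  module _ (p-prime : Prime p) where

    ∤⇒coprime : ∀ {n} → ¬ p ∣ℕ n → Coprime p n
    ∤⇒coprime p∤n (d∣p , d∣n) with prime⇒irreducible p-prime d∣p
    ... | inj₁ d≡1 = d≡1
    ... | inj₂ refl = contradiction d∣n p∤n

    mod-inverseℕ : ∀ {n} → ¬ p ∣ℕ n → ∃[ u ] + p ∣ u * + n - 1ℤ
    mod-inverseℕ {n} p∤n with coprime-Bézout (∤⇒coprime p∤n)
    ... | Bézout.+- x y eq = - + y , subst (+ p ∣_) (negate (+ y) (+ n))
                                       (∣m⇒∣-m (divides (+ x) (ℕ-affine⇒ℤ 1 y n x p eq)))
      where
      negate : ∀ y n → - (1ℤ + y * n) ≡ - y * n - 1ℤ
      negate = solve-∀
    ... | Bézout.-+ x y eq = + y , ≡+*⇒∣- (+ x) (sym (ℕ-affine⇒ℤ 1 x p y n eq))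

    mod-inverse : ∀ z → ¬ + p ∣ z → ∃[ u ] + p ∣ u * z - 1ℤ
    mod-inverse (+ n) p∤z = mod-inverseℕ (p∤z ∘ ∣ᵤ⇒∣ {+ p} {+ n})
    mod-inverse -[1+ n ] p∤z with mod-inverseℕ (p∤z ∘ ∣ᵤ⇒∣ {+ p} { -[1+ n ]})
    ... | u , p∣un-1 = - u , subst (+ p ∣_) (neg*neg (+ suc n) u) p∣un-1
      where
      neg*neg : ∀ a u → u * a - 1ℤ ≡ - u * - a - 1ℤ
      neg*neg = solve-∀

    multiples-cover : ∀ {z} → ¬ + p ∣ z → ∀ r → ∃[ j ] residue (+ j * z) ≡ r
    multiples-cover {z} p∤z r with mod-inverse z p∤z
    ... | u , p∣uz-1 = j , trans (∣⇒residue-≡ (+ j * z) (+ toℕ r) p∣jz-r) (residue-toℕ r)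
      where
      j = toℕ (residue (u * + toℕ r))
      regroup : ∀ j z r u → r * (u * z - 1ℤ) - z * (u * r - j) ≡ j * z - r
      regroup = solve-∀
      p∣jz-r : + p ∣ + j * z - + toℕ r
      p∣jz-r = subst (+ p ∣_) (regroup (+ j) z (+ toℕ r) u)
        (∣m∣n⇒∣m-n (∣n⇒∣m*n (+ toℕ r) p∣uz-1) (∣n⇒∣m*n z (∣-residue (u * + toℕ r))))

module Fractions where

  open import Defs using (_//_; sumRecip)
  open import Data.Nat.Base as ℕ using (suc)
  import Data.Nat.Coprimality as ℕ
  open import Data.Integer.Base using (ℤ; +_; -[1+_]; 0ℤ; _+_; _*_; -_; NonZero)
  open import Data.Integer.Properties
    using (*-cancelʳ-≡; *-cancelˡ-≡; *-comm; pos-*; neg-distribʳ-*)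
  open import Data.Integer.GCD using (gcd)
  open import Data.Integer.Coprimality using (coprime-divisor)
  open import Data.Integer.Divisibility using () renaming (_∣_ to _∣ᵤ_)
  open import Data.Integer.Divisibility.Signed using (_∣_; divides; ∣⇒∣ᵤ)
  open import Data.Integer.Tactic.RingSolver using (solve-∀)
  open import Data.Rational.Base as ℚ using (ℚ; mkℚ; ↥_; ↧_; ↧ₙ_; _/_)
  open import Data.Rational.Properties using (↥-/; ↧-/)
  open import Data.List.Base using (List; []; _∷_; map; foldr)
  open import Data.List.Relation.Unary.All using (All; []; _∷_)
  open import Relation.Nullary using (contradiction)
  open import Relation.Binary.PropositionalEquality
  open ≡-Reasoning

  sumℤ : List ℤ → ℤ
  sumℤ = foldr _+_ 0ℤ

  infix 4 _≈_⁄_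
  record _≈_⁄_ (q : ℚ) (z K : ℤ) : Set where
    constructor cross
    field cross-eq : ↥ q * K ≡ z * ↧ q

  /-≈ : ∀ z n .{{_ : ℕ.NonZero n}} → z / n ≈ z ⁄ + n
  /-≈ z n = cross (begin
    ↥ q * + n        ≡⟨ cong (↥ q *_) (↧-/ z n) ⟨
    ↥ q * (↧ q * g)  ≡⟨ regroup (↥ q) (↧ q) g ⟩
    ↥ q * g * ↧ q    ≡⟨ cong (_* ↧ q) (↥-/ z n) ⟩
    z * ↧ q          ∎)
    where
    q = z / n
    g = gcd z (+ n)
    regroup : ∀ a b c → a * (b * c) ≡ a * c * b
    regroup = solve-∀

  //-≈ : ∀ c {d} → d ≢ 0ℤ → c // d ≈ c ⁄ d
  //-≈ c {+ 0} d≢0 = contradiction refl d≢0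
  //-≈ c {+ suc n} _ = /-≈ c (suc n)
  //-≈ c { -[1+ n ]} _ with /-≈ (- c) (suc n)
  ... | cross ↥q*n≡-c*↧q = cross (begin
    ↥ q * - + suc n    ≡⟨ neg-distribʳ-* (↥ q) (+ suc n) ⟨
    - (↥ q * + suc n)  ≡⟨ cong -_ ↥q*n≡-c*↧q ⟩
    - (- c * ↧ q)      ≡⟨ neg-neg c (↧ q) ⟩
    c * ↧ q            ∎)
    where
    q = (- c) / suc n
    neg-neg : ∀ a b → - (- a * b) ≡ a * b
    neg-neg = solve-∀

  ≈-scale : ∀ e {q z K} → q ≈ z ⁄ K → q ≈ e * z ⁄ e * K
  ≈-scale e {q} {z} {K} (cross ↥q*K≡z*↧q) = cross (begin
    ↥ q * (e * K)    ≡⟨ regroup e (↥ q) K ⟩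
    e * (↥ q * K)    ≡⟨ cong (e *_) ↥q*K≡z*↧q ⟩
    e * (z * ↧ q)    ≡⟨ regroup′ e z (↧ q) ⟩
    e * z * ↧ q      ∎)
    where
    regroup : ∀ e a b → a * (e * b) ≡ e * (a * b)
    regroup = solve-∀
    regroup′ : ∀ e a b → e * (a * b) ≡ e * a * b
    regroup′ = solve-∀

  ≈-cancel : ∀ k {q z K} .{{_ : NonZero k}} → q ≈ k * z ⁄ k * K → q ≈ z ⁄ K
  ≈-cancel k {q} {z} {K} (cross ↥q*kK≡kz*↧q) = cross (*-cancelˡ-≡ k _ _ (begin
    k * (↥ q * K)    ≡⟨ regroup k (↥ q) K ⟩
    ↥ q * (k * K)    ≡⟨ ↥q*kK≡kz*↧q ⟩
    k * z * ↧ q      ≡⟨ regroup′ k z (↧ q) ⟩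
    k * (z * ↧ q)    ∎))
    where
    regroup : ∀ e a b → e * (a * b) ≡ a * (e * b)
    regroup = solve-∀
    regroup′ : ∀ e a b → e * a * b ≡ e * (a * b)
    regroup′ = solve-∀

  ≈-trans : ∀ {q n D z K} .{{_ : NonZero D}} → q ≈ n ⁄ D → n * K ≡ z * D → q ≈ z ⁄ K
  ≈-trans {q} {n} {D} {z} {K} (cross ↥q*D≡n*↧q) n*K≡z*D =
    cross (*-cancelʳ-≡ _ _ D (begin
      ↥ q * K * D    ≡⟨ swap (↥ q) K D ⟩
      ↥ q * D * K    ≡⟨ cong (_* K) ↥q*D≡n*↧q ⟩
      n * ↧ q * K    ≡⟨ swap n (↧ q) K ⟩
      n * K * ↧ q    ≡⟨ cong (_* ↧ q) n*K≡z*D ⟩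
      z * D * ↧ q    ≡⟨ swap z D (↧ q) ⟩
      z * ↧ q * D    ∎))
    where
    swap : ∀ a b c → a * b * c ≡ a * c * b
    swap = solve-∀

  ≈-+ : ∀ {q r a b K} → q ≈ a ⁄ K → r ≈ b ⁄ K → q ℚ.+ r ≈ a + b ⁄ K
  ≈-+ {q@record{}} {r@record{}} {a} {b} {K} (cross ↥q*K≡a*↧q) (cross ↥r*K≡b*↧r) =
    ≈-trans (/-≈ n (↧ₙ q ℕ.* ↧ₙ r)) (begin
      n * K                          ≡⟨ distrib (↥ q) (↧ r) (↥ r) (↧ q) K ⟩
      ↥ q * K * ↧ r + ↥ r * K * ↧ q  ≡⟨ cong₂ (λ x y → x * ↧ r + y * ↧ q) ↥q*K≡a*↧q ↥r*K≡b*↧r ⟩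
      a * ↧ q * ↧ r + b * ↧ r * ↧ q  ≡⟨ collect a b (↧ q) (↧ r) ⟩
      (a + b) * (↧ q * ↧ r)          ≡⟨ cong ((a + b) *_) (pos-* (↧ₙ q) (↧ₙ r)) ⟨
      (a + b) * + (↧ₙ q ℕ.* ↧ₙ r)    ∎)
    where
    n = ↥ q * ↧ r + ↥ r * ↧ q
    distrib : ∀ a b c d k → (a * b + c * d) * k ≡ a * k * b + c * k * d
    distrib = solve-∀
    collect : ∀ a b c d → a * c * d + b * d * c ≡ (a + b) * (c * d)
    collect = solve-∀

  sumRecip-≈ : ∀ {K} (w : ℤ → ℤ) {T} → All (λ n → (+ 1) // n ≈ w n ⁄ K) T →
               sumRecip T ≈ sumℤ (map w T) ⁄ K
  sumRecip-≈ w [] = cross refl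
  sumRecip-≈ w (n≈ ∷ T≈) = ≈-+ n≈ (sumRecip-≈ w T≈)

  ≈⇒↧∣ : ∀ {q z K} → q ≈ z ⁄ K → ↧ q ∣ᵤ K
  ≈⇒↧∣ {q@(mkℚ _ _ coprime)} {z} {K} (cross ↥q*K≡z*↧q) =
    coprime-divisor (↧ q) (↥ q) K (ℕ.sym (ℕ.recompute coprime)) (∣⇒∣ᵤ (divides z ↥q*K≡z*↧q))

  ≈-multiple⇒↧∣ : ∀ k {q z M} .{{_ : NonZero k}} → q ≈ z ⁄ k * M → k ∣ z → ↧ q ∣ᵤ M
  ≈-multiple⇒↧∣ k {q} {M = M} q≈z/kM (divides m refl) =
    ≈⇒↧∣ (≈-cancel k (subst (λ z → q ≈ z ⁄ k * M) (*-comm m k) q≈z/kM))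

module SubsetSums {p : ℕ} .{{_ : Data.Nat.Base.NonZero p}} (p-prime : Prime p) where

  open import Data.Nat.Base as ℕ using (zero; suc; _≤_; _<_; _∸_; s≤s)
  open import Data.Nat.Properties
    using (≤-antisym; ≤-trans; ≤-<-trans; ≤-reflexive; suc-pred; m≤n⇒m⊓n≡m)
  open import Data.Fin.Base using (toℕ)
  open import Data.Fin.Subset using (Subset; _∈_; _∪_; _⊂_; ⊤; ⁅_⁆; ∣_∣)
    renaming (_⊆_ to _⊆ₛ_)
  open import Data.Fin.Subset.Properties
    using (_∈?_; _⊂?_; p⊆p∪q; x∈p∪q⁺; x∈p∪q⁻; x∈⁅x⁆; x∈⁅y⁆⇒x≡y; ∣⁅x⁆∣≡1;
           p⊂q⇒∣p∣<∣q∣; ∣p∣≤n; ∣p∣≡n⇒p≡⊤; ∈⊤; ⊆⊤; ⊆-antisym; ∪-zeroˡ)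
  open import Data.Integer.Base using (ℤ; +_; 0ℤ; _+_; _-_; _*_; -_)
  open import Data.Integer.Properties using (suc-*)
  open import Data.Integer.Divisibility.Signed using (_∣_)
  open import Data.Integer.Tactic.RingSolver using (solve-∀)
  open import Data.List.Base using (List; []; _∷_; map; length; take)
  open import Data.List.Properties using (length-take)
  open import Data.List.Relation.Unary.All using (All; []; _∷_)
  open import Data.List.Relation.Unary.All.Properties using (take⁺)
  open import Data.List.Relation.Binary.Sublist.Propositional
    using (_⊆_; _∷_; _∷ʳ_; minimum; ⊆-trans)
  open import Data.List.Relation.Binary.Sublist.Propositional.Properties
    using (take-⊆; length-mono-≤)
  open import Data.Vec.Base using (tabulate; lookup)
  open import Data.Vec.Properties using (lookup∘tabulate; []=⇒lookup; lookup⇒[]=)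
  open import Data.Product using (∃-syntax; _×_; _,_)
  open import Data.Sum using (_⊎_; inj₁; inj₂)
  open import Relation.Nullary using (¬_; yes; no)
  open import Relation.Nullary.Decidable using (decidable-stable)
  open import Relation.Binary.PropositionalEquality

  open Residues p
  open Fractions using (sumℤ)

  shift : ℤ → Subset p → Subset p
  shift z A = tabulate (λ r → lookup A (residue (+ toℕ r - z)))

  ∈-shift⁻ : ∀ {z A r} → r ∈ shift z A → residue (+ toℕ r - z) ∈ A
  ∈-shift⁻ {A = A} {r} r∈ =
    lookup⇒[]= _ A (trans (sym (lookup∘tabulate _ r)) ([]=⇒lookup r∈))

  ∈-shift⁺ : ∀ {z A r} → residue (+ toℕ r - z) ∈ A → r ∈ shift z A
  ∈-shift⁺ {r = r} r-z∈A = lookup⇒[]= r _ (trans (lookup∘tabulate _ r) ([]=⇒lookup r-z∈A))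

  shift-closed⇒⊤ : ∀ {z A} → ¬ + p ∣ z → shift z A ⊆ₛ A → residue 0ℤ ∈ A → A ≡ ⊤
  shift-closed⇒⊤ {z} {A} p∤z closed 0∈A = ⊆-antisym ⊆⊤ λ {r} _ → every r
    where
    multiples : ∀ j → residue (+ j * z) ∈ A
    multiples zero = 0∈A
    multiples (suc j) = closed (∈-shift⁺ {z} {A} (subst (_∈ A) step (multiples j)))
      where
      x = + suc j * z
      r = + toℕ (residue x)
      regroup : ∀ j z r → z + j * z - r ≡ j * z - (r - z)
      regroup = solve-∀
      step : residue (+ j * z) ≡ residue (r - z)
      step = ∣⇒residue-≡ (+ j * z) (r - z) (subst (+ p ∣_) (regroup (+ j) z r)
               (subst (λ y → + p ∣ y - r) (suc-* (+ j) z) (∣-residue x)))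
    every : ∀ r → r ∈ A
    every r = let j , jz≡r = multiples-cover p-prime p∤z r in subst (_∈ A) jz≡r (multiples j)

  grows-or-⊤ : ∀ {z A} → ¬ + p ∣ z → residue 0ℤ ∈ A → A ⊂ A ∪ shift z A ⊎ A ≡ ⊤
  grows-or-⊤ {z} {A} p∤z 0∈A with A ⊂? A ∪ shift z A
  ... | yes A⊂ = inj₁ A⊂
  ... | no A⊄ = inj₂ (shift-closed⇒⊤ p∤z closed 0∈A)
    where
    closed : shift z A ⊆ₛ A
    closed {r} r∈ = decidable-stable (r ∈? A) λ r∉A →
      A⊄ (p⊆p∪q (shift z A) , r , x∈p∪q⁺ (inj₂ r∈) , r∉A)

  ≡⊤⇒∪≡⊤ : ∀ {A B : Subset p} → A ≡ ⊤ → A ∪ B ≡ ⊤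
  ≡⊤⇒∪≡⊤ {B = B} refl = ∪-zeroˡ B

  module _ {a} {A : Set a} (w : A → ℤ) where

    subsetSums : List A → Subset p
    subsetSums [] = ⁅ residue 0ℤ ⁆
    subsetSums (x ∷ xs) = subsetSums xs ∪ shift (w x) (subsetSums xs)

    0∈subsetSums : ∀ xs → residue 0ℤ ∈ subsetSums xs
    0∈subsetSums [] = x∈⁅x⁆ _
    0∈subsetSums (x ∷ xs) = x∈p∪q⁺ (inj₁ (0∈subsetSums xs))

    subsetSums-sound : ∀ {xs r} → r ∈ subsetSums xs →
                       ∃[ T ] T ⊆ xs × residue (sumℤ (map w T)) ≡ r
    subsetSums-sound {[]} r∈ = [] , minimum _ , sym (x∈⁅y⁆⇒x≡y _ r∈)
    subsetSums-sound {x ∷ xs} {r} r∈ with x∈p∪q⁻ _ _ r∈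
    ... | inj₁ r∈A with subsetSums-sound r∈A
    ...   | T , T⊆xs , ΣT≡r = T , x ∷ʳ T⊆xs , ΣT≡r
    subsetSums-sound {x ∷ xs} {r} r∈ | inj₂ r∈shift
      with subsetSums-sound (∈-shift⁻ {w x} {subsetSums xs} r∈shift)
    ...   | T , T⊆xs , ΣT≡r-wx =
      x ∷ T , refl ∷ T⊆xs , trans (∣⇒residue-≡ (w x + ΣT) (+ toℕ r) p∣wx+ΣT-r) (residue-toℕ r)
      where
      ΣT = sumℤ (map w T)
      regroup : ∀ s r z → s - (r - z) ≡ z + s - r
      regroup = solve-∀
      p∣wx+ΣT-r : + p ∣ w x + ΣT - + toℕ r
      p∣wx+ΣT-r = subst (+ p ∣_) (regroup ΣT (+ toℕ r) (w x))
                        (residue-≡⇒∣ ΣT (+ toℕ r - w x) ΣT≡r-wx)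

    Units : List A → Set a
    Units = All (λ x → ¬ + p ∣ w x)

    subsetSums-large : ∀ {xs} → Units xs →
                       subsetSums xs ≡ ⊤ ⊎ suc (length xs) ≤ ∣ subsetSums xs ∣
    subsetSums-large [] = inj₂ (≤-reflexive (sym (∣⁅x⁆∣≡1 (residue 0ℤ))))
    subsetSums-large {x ∷ xs} (p∤wx ∷ p∤ws) with subsetSums-large p∤ws
    ... | inj₁ full = inj₁ (≡⊤⇒∪≡⊤ full)
    ... | inj₂ large with grows-or-⊤ p∤wx (0∈subsetSums xs)
    ...   | inj₁ grows = inj₂ (≤-<-trans large (p⊂q⇒∣p∣<∣q∣ grows))
    ...   | inj₂ full = inj₁ (≡⊤⇒∪≡⊤ full)

    subsetSums-⊤ : ∀ {xs} → Units xs → p ∸ 1 ≤ length xs → subsetSums xs ≡ ⊤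
    subsetSums-⊤ {xs} p∤ws p-1≤n with subsetSums-large p∤ws
    ... | inj₁ full = full
    ... | inj₂ large = ∣p∣≡n⇒p≡⊤ (≤-antisym (∣p∣≤n (subsetSums xs))
            (≤-trans (≤-reflexive (sym (suc-pred p))) (≤-trans (s≤s p-1≤n) large)))

    subset-sum-cover : ∀ xs → Units xs → p ∸ 1 ≤ length xs → ∀ t →
                       ∃[ T ] T ⊆ xs × length T < p × + p ∣ t + sumℤ (map w T)
    subset-sum-cover xs p∤ws p-1≤n t =
      let T , T⊆L , ΣT≡-t = subsetSums-sound (subst (residue (- t) ∈_) (sym full) ∈⊤)
      in T , ⊆-trans T⊆L (take-⊆ (p ∸ 1) xs) , shorter T⊆L ,
         subst (+ p ∣_) (regroup (sumℤ (map w T)) t) (residue-≡⇒∣ (sumℤ (map w T)) (- t) ΣT≡-t)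
      where
      L = take (p ∸ 1) xs
      |L|≡p-1 : length L ≡ p ∸ 1
      |L|≡p-1 = trans (length-take (p ∸ 1) xs) (m≤n⇒m⊓n≡m p-1≤n)
      full : subsetSums L ≡ ⊤
      full = subsetSums-⊤ (take⁺ (p ∸ 1) p∤ws) (≤-reflexive (sym |L|≡p-1))
      shorter : ∀ {T} → T ⊆ L → length T < p
      shorter T⊆L = ≤-trans (s≤s (≤-trans (length-mono-≤ T⊆L) (≤-reflexive |L|≡p-1)))
                            (≤-reflexive (suc-pred p))
      regroup : ∀ s t → s - - t ≡ t + s
      regroup = solve-∀

open import Defs
open import Data.Nat using (ℕ; _≤_; _<_; _∸_)
open import Data.Nat.Primality using (Prime)
open import Data.Integer using (ℤ; +_; _*_)
open import Data.Integer.Divisibility using (_∣_)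
open import Data.Rational using (ℚ; _+_; ↧_)
open import Data.List using (List; length)
open import Data.List.Relation.Unary.All using (All)
open import Data.List.Relation.Unary.Unique.Propositional using (Unique)
open import Data.List.Relation.Binary.Sublist.Propositional using (_⊆_)
open import Data.Product using (Σ; _×_)
open import Relation.Binary.PropositionalEquality using (_≡_; _≢_)

open import Data.Nat as ℕ using (suc; _^_)
open import Data.Nat.Divisibility using (*-pres-∣; _∣0) renaming (_∣_ to _∣ℕ_)
open import Data.Nat.Primality using (prime⇒nonZero)
open import Data.Integer as ℤ using (0ℤ; ∣_∣)
open import Data.Integer.Properties using (abs-*; *-identityʳ)
import Data.Integer.Divisibility.Signed as Signed
open import Data.List using (map)
import Data.List.Relation.Unary.All as All
open import Data.List.Relation.Binary.Sublist.Propositional.Properties using (All-resp-⊆)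
open import Data.Product using (_,_)
open import Relation.Nullary using (¬_; yes; no; contradiction)
open import Relation.Binary.PropositionalEquality using (refl; sym; trans; cong; subst)
open Fractions

-- The quotient N / n, with junk value 0 when n ∤ N.
cofactor : ℤ → ℤ → ℤ
cofactor N n with n Signed.∣? N
... | yes n∣N = Signed.quotient n∣N
... | no _ = 0ℤ

cofactor-spec : ∀ N n → n ∣ N → N ≡ cofactor N n * n
cofactor-spec N n n∣N with n Signed.∣? N
... | yes n∣ˢN = Signed._∣_.equality n∣ˢN
... | no n∤ˢN = contradiction (Signed.∣ᵤ⇒∣ n∣N) n∤ˢN

//-≈-cofactor : ∀ c {d N} → d ≢ + 0 → d ∣ N → c // d ≈ cofactor N d * c ⁄ N
//-≈-cofactor c {d} {N} d≢0 d∣N = subst (c // d ≈ cofactor N d * c ⁄_) (sym (cofactor-spec N d d∣N))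
  (≈-scale (cofactor N d) (//-≈ c d≢0))

p∤cofactor : ∀ {p l N n} → ¬ (+ (p ^ suc l) ∣ N) → n ∣ N → + (p ^ l) ∣ n →
             ¬ (+ p Signed.∣ cofactor N n)
p∤cofactor {p} {l} {N} {n} p^[l+1]∤N n∣N p^l∣n p∣k =
  p^[l+1]∤N (subst (p ^ suc l ∣ℕ_) ∣k∣∣n∣≡∣N∣ (*-pres-∣ (Signed.∣⇒∣ᵤ p∣k) p^l∣n))
  where
  k = cofactor N n
  ∣k∣∣n∣≡∣N∣ : ∣ k ∣ ℕ.* ∣ n ∣ ≡ ∣ N ∣
  ∣k∣∣n∣≡∣N∣ = trans (sym (abs-* k n)) (cong ∣_∣ (sym (cofactor-spec N n n∣N)))

∤⇒≢0 : ∀ {m n} → ¬ (+ m ∣ n) → n ≢ + 0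
∤⇒≢0 m∤n refl = m∤n (_ ∣0)

lemma2 : (p l : ℕ) → Prime p → 1 ≤ l →
    (N : ℤ) → ExactlyDivides p l N →
    (c d : ℤ) → d ≢ + 0 → d ∣ N →
    (S : List ℤ) → Unique S →
    All (λ n → n ∣ N × ExactlyDivides p l n) S →
    p ∸ 1 ≤ length S →
    Σ (List ℤ) (λ T → T ⊆ S × length T < p ×
      ((M : ℤ) → N ≡ + p * M →
        (↧ ((c // d) + sumRecip T)) ∣ M))
lemma2 p l p-prime _ N (_ , p^[l+1]∤N) c d d≢0 d∣N S _ S-exact p-1≤|S| =
  let T , T⊆S , |T|<p , p∣numerator =
        subset-sum-cover (cofactor N) S units p-1≤|S| (cofactor N d * c)
  in T , T⊆S , |T|<p , λ M N≡pM →
       ≈-multiple⇒↧∣ (+ p) (subst (c // d + sumRecip T ≈ _ ⁄_) N≡pM (sum≈ T⊆S)) p∣numerator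
  where
  instance
    p≢0 : ℕ.NonZero p
    p≢0 = prime⇒nonZero p-prime
  open SubsetSums p-prime
  units : Units (cofactor N) S
  units = All.map (λ {n} (n∣N , p^l∣n , _) → p∤cofactor {p} {l} {N} {n} p^[l+1]∤N n∣N p^l∣n)
                  S-exact
  recips : All (λ n → (+ 1) // n ≈ cofactor N n ⁄ N) S
  recips = All.map (λ {n} (n∣N , _ , p^[l+1]∤n) → subst ((+ 1) // n ≈_⁄ N) (*-identityʳ _)
                     (//-≈-cofactor (+ 1) (∤⇒≢0 {n = n} p^[l+1]∤n) n∣N))
                   S-exact
  sum≈ : ∀ {T} → T ⊆ S →
         c // d + sumRecip T ≈ cofactor N d * c ℤ.+ sumℤ (map (cofactor N) T) ⁄ N
  sum≈ T⊆S = ≈-+ (//-≈-cofactor c d≢0 d∣N) (sumRecip-≈ (cofactor N) (All-resp-⊆ T⊆S recips))
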